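{- Let $m,d$ be positive integers and suppose there exists a Langford sequence $L=(l_1,l_2,\ldots,l_{2m})$ of order $m$ and defect $d$. Then for each odd positive integer $n$ there exists a Langford sequence $L'$ of order $mn$ and defect $d'=nd-(n-1)/2$.
   Context: For integers $a\le b$, $[a,b]=\{a,a+1,\ldots,b\}$. Let $d$ be a positive integer. A Langford sequence of order $m$ and defect $d$ is a sequence $(l_1,\ldots,l_{2m})$ of $2m$ integers such that (i) for every $k\in[d,d+m-1]$ there are exactly two subscripts $i,j\in[1,2m]$ with $l_i=l_j=k$, and (ii) these subscripts satisfy $|i-j|=k$. -}

module Defs where

open import Data.Nat using (ℕ; _+_; _*_; _≤_; _<_)
open import Data.Fin using (Fin; toℕ)
open import Data.Product using (Σ; _×_)
open import Data.Sum using (_⊎_)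
open import Relation.Binary.PropositionalEquality using (_≡_)

-- A sequence (l_1,...,l_{2m}) is a function Fin (m + m) → ℕ; position i
-- (0-based) corresponds to subscript i+1.  Differences of subscripts are
-- unaffected by the shift.
IsLangford : (m d : ℕ) → (Fin (m + m) → ℕ) → Set
IsLangford m d l =
  (k : ℕ) → d ≤ k → k < d + m →
  Σ (Fin (m + m)) λ i → Σ (Fin (m + m)) λ j →
    (toℕ i + k ≡ toℕ j) × (l i ≡ k) × (l j ≡ k) ×
    ((p : Fin (m + m)) → l p ≡ k → (p ≡ i ⊎ p ≡ j))

LangfordExists : (m d : ℕ) → Set
LangfordExists m d = Σ (Fin (m + m) → ℕ) λ l → IsLangford m d l

module Submission where

-- Cut a sequence of length 2mn into 2m blocks of n slots; block q is the
-- image of position q of the old sequence L.  If the old value k sits at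
-- positions i and i + k, then for every e < n the new value
-- k' = D + e + (k - d)n is placed in slot a of block i and in slot b of
-- block i + k, where a, b are the slots labelled e by two labellings of
-- the slots of a block ("first" and "second" occurrences) satisfying
-- b + t = a + e.  With D + t = dn the two new positions are exactly k'
-- apart, and every value of [D, D + mn) arises from exactly one pair (e, k).

open import Defs
open import Data.Fin using (Fin; toℕ; fromℕ<)
open import Data.Fin.Properties using (toℕ-fromℕ<; fromℕ<-toℕ; toℕ<n; toℕ-injective)
open import Data.Nat using (ℕ; zero; suc; _+_; _*_; _∸_; _≤_; _<_; _≟_; _≤?_; _<?_; z≤n; s≤s; NonZero)
open import Data.Nat.Properties
open import Data.Nat.DivMod using (_/_; _%_; m≡m%n+[m/n]*n; [m+kn]%n≡m%n; m<n⇒m%n≡m; m%n<n; m<n*o⇒m/o<n)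
open import Data.Nat.Tactic.RingSolver using (solve-∀)
open import Data.Product using (Σ; _×_; _,_)
open import Data.Sum using (_⊎_; inj₁; inj₂)
open import Data.Empty using (⊥-elim)
open import Relation.Nullary using (yes; no; contradiction)
open import Relation.Binary.PropositionalEquality

module _ {n : ℕ} .{{_ : NonZero n}} where

  %-digit : ∀ {r} q → r < n → (r + q * n) % n ≡ r
  %-digit {r} q r<n = trans ([m+kn]%n≡m%n r q n) (m<n⇒m%n≡m r<n)

  /-digit : ∀ {r} q → r < n → (r + q * n) / n ≡ q
  /-digit {r} q r<n = *-cancelʳ-≡ ((r + q * n) / n) q n
    (+-cancelˡ-≡ r _ _ (sym (trans (m≡m%n+[m/n]*n (r + q * n) n)
      (cong (λ s → s + (r + q * n) / n * n) (%-digit q r<n)))))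

  digits-unique : ∀ {r r' q q'} → r < n → r' < n →
    r + q * n ≡ r' + q' * n → r ≡ r' × q ≡ q'
  digits-unique {q = q} {q'} r<n r'<n eq =
    trans (sym (%-digit q r<n)) (trans (cong (_% n) eq) (%-digit q' r'<n)) ,
    trans (sym (/-digit q r<n)) (trans (cong (_/ n) eq) (/-digit q' r'<n))

record PairAt (M : ℕ) (L : ℕ → ℕ) (k : ℕ) : Set where
  field
    pos     : ℕ
    fits    : pos + k < M + M
    at-pos  : L pos ≡ k
    at-next : L (pos + k) ≡ k
    only    : ∀ p → L p ≡ k → p ≡ pos ⊎ p ≡ pos + k

IsLangfordℕ : (M D : ℕ) → (ℕ → ℕ) → Set
IsLangfordℕ M D L = ∀ k → D ≤ k → k < D + M → PairAt M L k

module _ (M : ℕ) where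

  extend : (Fin (M + M) → ℕ) → ℕ → ℕ
  extend l x with x <? M + M
  ... | yes x< = l (fromℕ< x<)
  ... | no _   = 0

  extend-toℕ : ∀ l p → extend l (toℕ p) ≡ l p
  extend-toℕ l p with toℕ p <? M + M
  ... | yes p< = cong l (fromℕ<-toℕ p p<)
  ... | no p≮ = contradiction (toℕ<n p) p≮

  -- The padding value 0 lies below the defect, so it creates no new pairs.
  fromFin : ∀ {D l} → 1 ≤ D → IsLangford M D l → IsLangfordℕ M D (extend l)
  fromFin {D} {l} 1≤D isL k D≤k k< with isL k D≤k k<
  ... | i , j , i+k≡j , li , lj , onlyFin = record
    { pos     = toℕ i
    ; fits    = subst (_< M + M) (sym i+k≡j) (toℕ<n j)
    ; at-pos  = trans (extend-toℕ l i) li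
    ; at-next = trans (cong (extend l) i+k≡j) (trans (extend-toℕ l j) lj)
    ; only    = onlyℕ }
    where
    onlyℕ : ∀ p → extend l p ≡ k → p ≡ toℕ i ⊎ p ≡ toℕ i + k
    onlyℕ p lp with p <? M + M
    ... | no _ = ⊥-elim (<⇒≢ (≤-trans 1≤D D≤k) lp)
    ... | yes p< with onlyFin (fromℕ< p<) lp
    ...   | inj₁ eq = inj₁ (trans (sym (toℕ-fromℕ< p<)) (cong toℕ eq))
    ...   | inj₂ eq = inj₂ (trans (sym (toℕ-fromℕ< p<)) (trans (cong toℕ eq) (sym i+k≡j)))

  toFin : ∀ {D L} → IsLangfordℕ M D L → IsLangford M D (λ p → L (toℕ p))
  toFin {D} {L} lang k D≤k k< =
    fromℕ< i< , fromℕ< fits ,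
    trans (cong (_+ k) (toℕ-fromℕ< i<)) (sym (toℕ-fromℕ< fits)) ,
    trans (cong L (toℕ-fromℕ< i<)) at-pos ,
    trans (cong L (toℕ-fromℕ< fits)) at-next ,
    onlyFin
    where
    open PairAt (lang k D≤k k<)
    i< : pos < M + M
    i< = ≤-<-trans (m≤m+n pos k) fits
    onlyFin : ∀ p → L (toℕ p) ≡ k → p ≡ fromℕ< i< ⊎ p ≡ fromℕ< fits
    onlyFin p lp with only (toℕ p) lp
    ... | inj₁ eq = inj₁ (toℕ-injective (trans eq (sym (toℕ-fromℕ< i<))))
    ... | inj₂ eq = inj₂ (toℕ-injective (trans eq (sym (toℕ-fromℕ< fits))))

-- The slots a (labelled e by `first`) and b (labelled e by `second`) of a
-- block of size n; their offset b + t = a + e is what makes the blow-up work.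
record Slots (n t : ℕ) (first second : ℕ → ℕ) (e : ℕ) : Set where
  field
    a b      : ℕ
    a<n      : a < n
    b<n      : b < n
    first-a  : first a ≡ e
    second-b : second b ≡ e
    offset   : b + t ≡ a + e

record BlockPattern (n t : ℕ) : Set where
  field
    first second     : ℕ → ℕ
    first<n          : ∀ {r} → r < n → first r < n
    second<n         : ∀ {r} → r < n → second r < n
    first-injective  : ∀ {r r'} → r < n → r' < n → first r ≡ first r' → r ≡ r'
    second-injective : ∀ {r r'} → r < n → r' < n → second r ≡ second r' → r ≡ r'
    slots            : ∀ {e} → e < n → Slots n t first second e

data Parity : ℕ → Set where
  even : ∀ c → Parity (c + c)
  odd  : ∀ c → Parity (suc (c + c))

parity : ∀ r → Parity r
parity zero = even zero
parity (suc r) with parity r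
... | even c = odd c
... | odd c  = subst Parity (cong suc (+-suc c c)) (even (suc c))

half-≤ : ∀ {c t} → c + c ≤ t + t → c ≤ t
half-≤ {c} {t} h with c ≤? t
... | yes c≤t = c≤t
... | no c≰t  = contradiction h (<⇒≱ (+-mono-< (≰⇒> c≰t) (≰⇒> c≰t)))

half-< : ∀ {c t} → c + c < t + t → c < t
half-< {c} {t} h with c <? t
... | yes c<t = c<t
... | no c≮t  = contradiction h (≤⇒≯ (+-mono-≤ (≮⇒≥ c≮t) (≮⇒≥ c≮t)))

-- The block pattern of odd size n = 2t + 1.  Label e sits in slot
-- a = e + t + 1 (mod n) as a first label and in slot b = 2e + 1 (mod n)
-- as a second label; concretely, for e = t + f (f ≤ t) the slots are f and
-- 2f, and for e < t they are t + 1 + e and 2e + 1.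
module OddPattern (t : ℕ) where

  n : ℕ
  n = suc (t + t)

  first : ℕ → ℕ
  first r with r ≤? t
  ... | yes _ = r + t
  ... | no _  = r ∸ suc t

  second : ℕ → ℕ
  second zero          = t
  second (suc zero)    = zero
  second (suc (suc r)) = suc (second r)

  first-low : ∀ {r} → r ≤ t → first r ≡ r + t
  first-low {r} r≤t with r ≤? t
  ... | yes _  = refl
  ... | no r≰t = contradiction r≤t r≰t

  first-high : ∀ f → first (suc (t + f)) ≡ f
  first-high f with suc (t + f) ≤? t
  ... | yes h = contradiction h (<⇒≱ (s≤s (m≤m+n t f)))
  ... | no _  = m+n∸m≡n t f

  second-even : ∀ c → second (c + c) ≡ t + c
  second-even zero = sym (+-identityʳ t)
  second-even (suc c) rewrite +-suc c c = trans (cong suc (second-even c)) (sym (+-suc t c))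

  second-odd : ∀ c → second (suc (c + c)) ≡ c
  second-odd zero = refl
  second-odd (suc c) rewrite +-suc c c = cong suc (second-odd c)

  low-or-high : ∀ r → r ≤ t ⊎ Σ ℕ λ f → r ≡ suc (t + f)
  low-or-high r with r ≤? t
  ... | yes r≤t = inj₁ r≤t
  ... | no r≰t  = inj₂ (r ∸ suc t , sym (m+[n∸m]≡n (≰⇒> r≰t)))

  high<t : ∀ {f} → suc (t + f) < n → f < t
  high<t h = +-cancelˡ-< t _ t (≤-pred h)

  -- Low slots get first labels ≥ t, high slots get first labels < t.
  first-low≢high : ∀ {r f} → r ≤ t → f < t → first r ≢ first (suc (t + f))
  first-low≢high {r} {f} r≤t f<t eq =
    <⇒≱ f<t (subst (t ≤_) (trans (sym (first-low r≤t)) (trans eq (first-high f))) (m≤n+m t r))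

  -- Even slots get second labels ≥ t, odd slots get second labels < t.
  second-even≢odd : ∀ {c c'} → c' < t → second (c + c) ≢ second (suc (c' + c'))
  second-even≢odd {c} {c'} c'<t eq =
    <⇒≱ c'<t (subst (t ≤_) (trans (sym (second-even c)) (trans eq (second-odd c'))) (m≤m+n t c))

  first<n : ∀ {r} → r < n → first r < n
  first<n {r} r<n with low-or-high r
  ... | inj₁ r≤t = subst (_< n) (sym (first-low r≤t)) (s≤s (+-monoˡ-≤ t r≤t))
  ... | inj₂ (f , refl) rewrite first-high f = ≤-<-trans (m≤n+m f (suc t)) r<n

  second<n : ∀ {r} → r < n → second r < n
  second<n {r} r<n with parity r
  ... | even c rewrite second-even c = s≤s (+-monoʳ-≤ t (half-≤ (≤-pred r<n)))
  ... | odd c rewrite second-odd c = ≤-<-trans (m≤m+n c c) (<-trans (n<1+n _) r<n)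

  first-injective : ∀ {r r'} → r < n → r' < n → first r ≡ first r' → r ≡ r'
  first-injective {r} {r'} r<n r'<n eq with low-or-high r | low-or-high r'
  ... | inj₁ r≤t | inj₁ r'≤t =
    +-cancelʳ-≡ t r r' (trans (sym (first-low r≤t)) (trans eq (first-low r'≤t)))
  ... | inj₂ (f , refl) | inj₂ (f' , refl) =
    cong (λ x → suc (t + x)) (trans (sym (first-high f)) (trans eq (first-high f')))
  ... | inj₁ r≤t | inj₂ (f' , refl) = contradiction eq (first-low≢high r≤t (high<t r'<n))
  ... | inj₂ (f , refl) | inj₁ r'≤t = contradiction (sym eq) (first-low≢high r'≤t (high<t r<n))

  second-injective : ∀ {r r'} → r < n → r' < n → second r ≡ second r' → r ≡ r'
  second-injective {r} {r'} r<n r'<n eq with parity r | parity r'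
  ... | even c | even c' =
    cong (λ x → x + x) (+-cancelˡ-≡ t c c' (trans (sym (second-even c)) (trans eq (second-even c'))))
  ... | odd c | odd c' =
    cong (λ x → suc (x + x)) (trans (sym (second-odd c)) (trans eq (second-odd c')))
  ... | even c | odd c' = contradiction eq (second-even≢odd {c} {c'} (half-< (≤-pred r'<n)))
  ... | odd c | even c' = contradiction (sym eq) (second-even≢odd {c'} {c} (half-< (≤-pred r<n)))

  slots-high : ∀ {f} → f ≤ t → Slots n t first second (t + f)
  slots-high {f} f≤t = record
    { a = f ; b = f + f
    ; a<n = s≤s (≤-trans f≤t (m≤m+n t t))
    ; b<n = s≤s (+-mono-≤ f≤t f≤t)
    ; first-a = trans (first-low f≤t) (+-comm f t)
    ; second-b = second-even f
    ; offset = offset f t }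
    where
    offset : ∀ f t → f + f + t ≡ f + (t + f)
    offset = solve-∀

  slots-low : ∀ {e} → e < t → Slots n t first second e
  slots-low {e} e<t = record
    { a = suc (t + e) ; b = suc (e + e)
    ; a<n = s≤s (+-monoʳ-< t e<t)
    ; b<n = s≤s (+-mono-< e<t e<t)
    ; first-a = first-high e
    ; second-b = second-odd e
    ; offset = offset e t }
    where
    offset : ∀ e t → suc (e + e) + t ≡ suc (t + e) + e
    offset = solve-∀

  oddPattern : BlockPattern n t
  oddPattern = record
    { first = first ; second = second
    ; first<n = first<n ; second<n = second<n
    ; first-injective = first-injective ; second-injective = second-injective
    ; slots = slots }
    where
    slots : ∀ {e} → e < n → Slots n t first second e
    slots {e} e<n with t ≤? e
    ... | yes t≤e = subst (Slots n t first second) (m+[n∸m]≡n t≤e)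
                      (slots-high (+-cancelˡ-≤ t (e ∸ t) t (≤-pred
                        (subst (_< n) (sym (m+[n∸m]≡n t≤e)) e<n))))
    ... | no t≰e = slots-low (≰⇒> t≰e)

-- The offset of the slots makes the two new positions exactly one new value
-- apart: slot a of block i plus D + e + x n is slot b of block i + d + x.
block-gap : ∀ {a b e t D d n} i x → b + t ≡ a + e → D + t ≡ d * n →
  (a + i * n) + (D + (e + x * n)) ≡ b + (i + (d + x)) * n
block-gap {a} {b} {e} {t} {D} {d} {n} i x offset defect = +-cancelʳ-≡ t _ _ (begin
  a + i * n + (D + (e + x * n)) + t ≡⟨ regroup₁ a e D t i x n ⟩
  (a + e) + (D + t) + (i + x) * n   ≡⟨ cong₂ (λ u v → u + v + (i + x) * n) (sym offset) defect ⟩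
  (b + t) + d * n + (i + x) * n     ≡⟨ regroup₂ b t d i x n ⟩
  b + (i + (d + x)) * n + t         ∎)
  where
  open ≡-Reasoning
  regroup₁ : ∀ a e D t i x n → a + i * n + (D + (e + x * n)) + t ≡ (a + e) + (D + t) + (i + x) * n
  regroup₁ = solve-∀
  regroup₂ : ∀ b t d i x n → (b + t) + d * n + (i + x) * n ≡ b + (i + (d + x)) * n + t
  regroup₂ = solve-∀

module Inflation {n t : ℕ} .{{_ : NonZero n}} (P : BlockPattern n t)
                 (m d D : ℕ) (defect : D + t ≡ d * n) (1≤d : 1 ≤ d) (1≤D : 1 ≤ D) where

  open BlockPattern P

  code : ℕ → ℕ → ℕ
  code e k = D + (e + (k ∸ d) * n)

  code-injective : ∀ {e e' k k'} → e < n → e' < n → d ≤ k → d ≤ k' →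
    code e k ≡ code e' k' → e ≡ e' × k ≡ k'
  code-injective e<n e'<n d≤k d≤k' eq with digits-unique e<n e'<n (+-cancelˡ-≡ D _ _ eq)
  ... | e≡e' , x≡x' = e≡e' , ∸-cancelʳ-≡ d≤k d≤k' x≡x'

  code-onto : ∀ {k'} → D ≤ k' → k' < D + m * n →
    Σ ℕ λ e → Σ ℕ λ k → e < n × d ≤ k × k < d + m × code e k ≡ k'
  code-onto {k'} D≤k' k'< =
    u % n , d + u / n , m%n<n u n , m≤m+n d _ , +-monoʳ-< d (m<n*o⇒m/o<n u<) , code≡
    where
    open ≡-Reasoning
    u : ℕ
    u = k' ∸ D
    u< : u < m * n
    u< = +-cancelˡ-< D u (m * n) (subst (_< D + m * n) (sym (m+[n∸m]≡n D≤k')) k'<)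
    code≡ : code (u % n) (d + u / n) ≡ k'
    code≡ = begin
      D + (u % n + (d + u / n ∸ d) * n) ≡⟨ cong (λ x → D + (u % n + x * n)) (m+n∸m≡n d (u / n)) ⟩
      D + (u % n + u / n * n)           ≡⟨ cong (D +_) (sym (m≡m%n+[m/n]*n u n)) ⟩
      D + u                             ≡⟨ m+[n∸m]≡n D≤k' ⟩
      k'                                ∎

  -- The entry of slot r in a block whose old value is v, where w is the old
  -- value v places further: w ≡ v means the block is the first occurrence.
  entry : (v w r : ℕ) → ℕ
  entry v w r with d ≤? v | v <? d + m | w ≟ v
  ... | yes _ | yes _ | yes _ = code (first r) v
  ... | yes _ | yes _ | no _  = code (second r) v
  ... | _     | _     | _     = 0

  entry-first : ∀ {v r} → d ≤ v → v < d + m → entry v v r ≡ code (first r) v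
  entry-first {v} d≤v v< with d ≤? v | v <? d + m | v ≟ v
  ... | yes _ | yes _ | yes _ = refl
  ... | yes _ | yes _ | no v≢v = contradiction refl v≢v
  ... | yes _ | no v≮ | _ = contradiction v< v≮
  ... | no d≰v | _ | _ = contradiction d≤v d≰v

  entry-second : ∀ {v w r} → d ≤ v → v < d + m → w ≢ v → entry v w r ≡ code (second r) v
  entry-second {v} {w} d≤v v< w≢v with d ≤? v | v <? d + m | w ≟ v
  ... | yes _ | yes _ | yes w≡v = contradiction w≡v w≢v
  ... | yes _ | yes _ | no _ = refl
  ... | yes _ | no v≮ | _ = contradiction v< v≮
  ... | no d≰v | _ | _ = contradiction d≤v d≰v

  entry-positive : ∀ {v w r} → 0 < entry v w r → d ≤ v ×
    ((w ≡ v × entry v w r ≡ code (first r) v) ⊎ (w ≢ v × entry v w r ≡ code (second r) v))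
  entry-positive {v} {w} {r} pos with d ≤? v | v <? d + m | w ≟ v
  ... | yes d≤v | yes _ | yes w≡v = d≤v , inj₁ (w≡v , refl)
  ... | yes d≤v | yes _ | no w≢v = d≤v , inj₂ (w≢v , refl)
  ... | yes _ | no _ | _ = ⊥-elim (<-irrefl refl pos)
  ... | no _ | _ | _ = ⊥-elim (<-irrefl refl pos)

  inflate : (ℕ → ℕ) → ℕ → ℕ
  inflate L p = entry (L (p / n)) (L (p / n + L (p / n))) (p % n)

  inflate-digits : ∀ L {r} q → r < n → inflate L (r + q * n) ≡ entry (L q) (L (q + L q)) r
  inflate-digits L q r<n =
    cong₂ (λ q' r' → entry (L q') (L (q' + L q')) r') (/-digit q r<n) (%-digit q r<n)

  new-pair : ∀ {L k e} → d ≤ k → k < d + m → e < n → PairAt m L k →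
    PairAt (m * n) (inflate L) (code e k)
  new-pair {L} {k} {e} d≤k k< e<n old = record
    { pos = a + i * n ; fits = fits' ; at-pos = at-pos' ; at-next = at-next' ; only = only' }
    where
    open PairAt old renaming (pos to i)
    open Slots (slots e<n)

    gap : a + i * n + code e k ≡ b + (i + k) * n
    gap = trans (block-gap {a} {e = e} i (k ∸ d) offset defect) (cong (λ k → b + (i + k) * n) (m+[n∸m]≡n d≤k))

    no-third : L (i + k + k) ≢ k
    no-third third with only (i + k + k) third
    ... | inj₁ eq = <⇒≢ (≤-trans (m<m+n i k>0) (m≤m+n (i + k) k)) (sym eq)
      where k>0 = ≤-trans 1≤d d≤k
    ... | inj₂ eq = <⇒≢ (m<m+n (i + k) k>0) (sym eq)
      where k>0 = ≤-trans 1≤d d≤k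

    fits' : a + i * n + code e k < m * n + m * n
    fits' = subst (_< m * n + m * n) (sym gap) (begin-strict
      b + (i + k) * n <⟨ +-monoˡ-< ((i + k) * n) b<n ⟩
      suc (i + k) * n ≤⟨ *-monoˡ-≤ n fits ⟩
      (m + m) * n     ≡⟨ *-distribʳ-+ n m m ⟩
      m * n + m * n   ∎)
      where open ≤-Reasoning

    at-pos' : inflate L (a + i * n) ≡ code e k
    at-pos' = begin
      inflate L (a + i * n)          ≡⟨ inflate-digits L i a<n ⟩
      entry (L i) (L (i + L i)) a    ≡⟨ cong (λ v → entry v (L (i + v)) a) at-pos ⟩
      entry k (L (i + k)) a          ≡⟨ cong (λ w → entry k w a) at-next ⟩
      entry k k a                    ≡⟨ entry-first d≤k k< ⟩
      code (first a) k               ≡⟨ cong (λ x → code x k) first-a ⟩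
      code e k                       ∎
      where open ≡-Reasoning

    at-next' : inflate L (a + i * n + code e k) ≡ code e k
    at-next' = begin
      inflate L (a + i * n + code e k)                ≡⟨ cong (inflate L) gap ⟩
      inflate L (b + (i + k) * n)                     ≡⟨ inflate-digits L (i + k) b<n ⟩
      entry (L (i + k)) (L (i + k + L (i + k))) b     ≡⟨ cong (λ v → entry v (L (i + k + v)) b) at-next ⟩
      entry k (L (i + k + k)) b                       ≡⟨ entry-second d≤k k< no-third ⟩
      code (second b) k                               ≡⟨ cong (λ x → code x k) second-b ⟩
      code e k                                        ∎
      where open ≡-Reasoning

    -- Slot r of block q holding code e k lies in a block of the old value k
    -- (so q ∈ {i, i + k}); whether the block is a first or second occurrence
    -- and the injectivity of the labellings then pin down q and r.
    in-block : ∀ {r} q → r < n → entry (L q) (L (q + L q)) r ≡ code e k →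
      r + q * n ≡ a + i * n ⊎ r + q * n ≡ a + i * n + code e k
    in-block {r} q r<n hit with entry-positive (subst (0 <_) (sym hit) (≤-trans 1≤D (m≤m+n D _)))
    ... | d≤v , inj₁ (w≡v , val) with code-injective (first<n r<n) e<n d≤v d≤k (trans (sym val) hit)
    ...   | label≡ , v≡k with only q v≡k
    ...     | inj₁ q≡i = inj₁ (cong₂ (λ r q → r + q * n)
                           (first-injective r<n a<n (trans label≡ (sym first-a))) q≡i)
    ...     | inj₂ q≡i+k = ⊥-elim (no-third (subst (λ q → L (q + k) ≡ k) q≡i+k
                           (trans (cong (λ v → L (q + v)) (sym v≡k)) (trans w≡v v≡k))))
    in-block {r} q r<n hit | d≤v , inj₂ (w≢v , val)
      with code-injective (second<n r<n) e<n d≤v d≤k (trans (sym val) hit)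
    ...   | label≡ , v≡k with only q v≡k
    ...     | inj₁ q≡i = ⊥-elim (w≢v (trans (cong (λ v → L (q + v)) v≡k)
                           (trans (cong (λ q → L (q + k)) q≡i) (trans at-next (sym v≡k)))))
    ...     | inj₂ q≡i+k = inj₂ (trans (cong₂ (λ r q → r + q * n)
                           (second-injective r<n b<n (trans label≡ (sym second-b))) q≡i+k) (sym gap))

    only' : ∀ p → inflate L p ≡ code e k → p ≡ a + i * n ⊎ p ≡ a + i * n + code e k
    only' p hit = subst (λ x → x ≡ a + i * n ⊎ x ≡ a + i * n + code e k)
      (sym (m≡m%n+[m/n]*n p n)) (in-block (p / n) (m%n<n p n) hit)

  inflate-langford : ∀ {L} → IsLangfordℕ m d L → IsLangfordℕ (m * n) D (inflate L)
  inflate-langford lang k' D≤k' k'< with code-onto D≤k' k'<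
  ... | e , k , e<n , d≤k , k< , refl = new-pair d≤k k< e<n (lang k d≤k k<)

theorem3p1 : (m d t : ℕ) → 1 ≤ m → 1 ≤ d → LangfordExists m d →
    LangfordExists (m * (2 * t + 1)) ((2 * t + 1) * d ∸ t)
theorem3p1 m zero t _ () _
theorem3p1 m d@(suc d0) t _ 1≤d (l , isL) =
  subst₂ LangfordExists (cong (m *_) n≡) D≡
    (_ , toFin (m * n) (inflate-langford (fromFin m 1≤d isL)))
  where
  open OddPattern t using (n; oddPattern)
  D : ℕ
  D = suc (t + d0 * n)
  defect : D + t ≡ d * n
  defect = lemma t d0
    where
    lemma : ∀ t d0 → suc (t + d0 * suc (t + t)) + t ≡ suc d0 * suc (t + t)
    lemma = solve-∀
  n≡ : n ≡ 2 * t + 1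
  n≡ = lemma t
    where
    lemma : ∀ t → suc (t + t) ≡ 2 * t + 1
    lemma = solve-∀
  D≡ : D ≡ (2 * t + 1) * d ∸ t
  D≡ = sym (trans (cong (λ x → x * d ∸ t) (sym n≡))
                  (trans (cong (_∸ t) (trans (*-comm n d) (sym defect))) (m+n∸n≡m D t)))
  open Inflation oddPattern m d D defect 1≤d (s≤s z≤n)
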